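{- The linear map $\psi:\mathbb{K}\mathbf{T}\to\mathbf{PLie}$ defined, for every finite set $V$ and every tree $t\in\mathbf{T}[V]$, by $\psi(t)=\sum_{r\in V}(t,r)$, is an injective morphism of operads.
   Context: Work over a field $\mathbb{K}$ of characteristic zero, with operads in the species formalism (spaces indexed by nonempty finite sets, equivariant partial compositions $\circ_\ast$ for disjoint $V_1\ni\ast$ and $V_2$, landing in arity $(V_1\setminus\{\ast\})\sqcup V_2$). $\mathbf{T}[V]$ is the set of trees (connected acyclic simple graphs) on vertex set $V$. $\mathbb{K}\mathbf{T}$ is the operad with basis $\mathbf{T}[V]$ and partial composition $t_1\circ_\ast t_2=\sum_{f:N_\ast\to V_2}\big((t_1\setminus\{\ast\})\cup t_2\cup\bigcup_{v\in N_\ast}\{\{v,f(v)\}\}\big)$, where $N_\ast$ is the set of neighbours of $\ast$ in $t_1$ and $t_1\setminus\{\ast\}$ is $t_1$ with $\ast$ and its incident edges removed (a suboperad of the graph insertion operad). $\mathbf{PLie}$ is the pre-Lie operad: $\mathbf{PLie}[V]$ has as basis the rooted trees $(t,r)$ with $t\in\mathbf{T}[V]$, $r\in V$. For $(t_1,r_1)$ on $V_1\ni\ast$ and $(t_2,r_2)$ on $V_2$, $(t_1,r_1)\circ_\ast(t_2,r_2)$ is the sum, over all maps $f$ from the set $C$ of children of $\ast$ in $(t_1,r_1)$ to $V_2$, of the rooted tree obtained by: removing $\ast$; adding the edges of $t_2$; joining the parent of $\ast$ (if $\ast\neq r_1$) to $r_2$; joining each $c\in C$ to $f(c)$; taking as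 root $r_1$ if $r_1\neq\ast$ and $r_2$ otherwise. -}

module Defs where

open import Level using (Level; _⊔_) renaming (suc to lsuc)
open import Data.Nat using (ℕ; zero; suc; _≤_) renaming (_+_ to _ℕ+_)
open import Data.Fin using (Fin; zero; suc; _≟_; punchIn; punchOut; splitAt; _↑ˡ_; _↑ʳ_)
open import Data.Fin.Permutation using (Permutation′; _⟨$⟩ʳ_; _⟨$⟩ˡ_)
open import Data.Bool using (Bool; true; false; _∧_; _∨_; not; if_then_else_)
open import Data.List using (List; []; _∷_; _++_; [_]; map; concatMap; filter; foldr; length)
open import Data.Bool.ListAction using (any; all)
open import Data.List.Relation.Unary.All using (All)
open import Data.List.Relation.Unary.Linked using (Linked)
open import Data.List.Relation.Unary.Unique.Propositional using (Unique)
open import Data.Product using (_×_; _,_; Σ; ∃; proj₁; proj₂)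
open import Data.Sum using (_⊎_; inj₁; inj₂)
open import Relation.Nullary using (¬_; yes; no; does)
open import Relation.Binary.PropositionalEquality using (_≡_)
open import Algebra.Bundles using (CommutativeRing)

record Field (c ℓ : Level) : Set (lsuc (c ⊔ ℓ)) where
  field
    commutativeRing : CommutativeRing c ℓ
  open CommutativeRing commutativeRing public
  field
    0≉1     : ¬ (0# ≈ 1#)
    inverse : ∀ x → ¬ (x ≈ 0#) → ∃ λ y → (x * y) ≈ 1#

module _ {c ℓ} (K : Field c ℓ) where
  open Field K

  fromℕ : ℕ → Carrier
  fromℕ zero    = 0#
  fromℕ (suc n) = 1# + fromℕ n

  CharacteristicZero : Set ℓ
  CharacteristicZero = ∀ n → ¬ (fromℕ (suc n) ≈ 0#)

-- Finite sets: the skeleton Fin n (n ≥ 1 for nonempty sets).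
-- Simple graphs on Fin n, given by a (Boolean) adjacency relation.

Graph : ℕ → Set
Graph n = Fin n → Fin n → Bool

allFin : ∀ n → List (Fin n)
allFin zero    = []
allFin (suc n) = zero ∷ map suc (allFin n)

_==_ : ∀ {n} → Fin n → Fin n → Bool
a == b = does (a ≟ b)

Adj : ∀ {n} → Graph n → Fin n → Fin n → Set
Adj g u v = g u v ≡ true

Path : ∀ {n} → Graph n → Fin n → Fin n → Set
Path g u v = (u ≡ v) ⊎ (Σ (List _) λ ws → Linked (Adj g) (u ∷ ws ++ [ v ]))

Cycle : ∀ {n} → Graph n → Set
Cycle g = Σ _ λ v → Σ (List _) λ ws →
            (2 ≤ length ws) × Unique (v ∷ ws) × Linked (Adj g) (v ∷ ws ++ [ v ])

record IsTree {n} (g : Graph n) : Set where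
  field
    symmetric   : ∀ u v → g u v ≡ g v u
    irreflexive : ∀ u → g u u ≡ false
    connected   : ∀ u v → Path g u v
    acyclic     : ¬ Cycle g

eqGraph : ∀ {n} → Graph n → Graph n → Bool
eqGraph {n} g h = all (λ u → all (λ v → does (Data.Bool._≟_ (g u v) (h u v))) (allFin n)) (allFin n)
  where import Data.Bool

eqRooted : ∀ {n} → Graph n × Fin n → Graph n × Fin n → Bool
eqRooted (g , r) (h , s) = eqGraph g h ∧ (r == s)

-- Vertex sets of a partial composition: V1 = Fin (suc m) with * = i,
-- V2 = Fin k; result on (V1 ∖ {*}) ⊔ V2 ≅ Fin m ⊎ Fin k ≅ Fin (m ℕ+ k),
-- where Fin m ≅ V1 ∖ {i} via punchIn i.

allMaps : ∀ {A : Set} k → List A → List (List (A × Fin k))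
allMaps k []       = [] ∷ []
allMaps k (a ∷ as) = concatMap (λ w → map ((a , w) ∷_) (allMaps k as)) (allFin k)

lookupMap : ∀ {m k} → List (Fin m × Fin k) → Fin m → Fin k → Bool
lookupMap f u w = any (λ p → (proj₁ p == u) ∧ (proj₂ p == w)) f

neighbours : ∀ {m} → Graph (suc m) → Fin (suc m) → List (Fin m)
neighbours {m} g i = filter (λ u → g i (punchIn i u) Data.Bool.≟ true) (allFin m)
  where import Data.Bool

glue : ∀ m {k} → Graph m → Graph k → (Fin m → Fin k → Bool) → Graph (m ℕ+ k)
glue m g h e a b with splitAt m a | splitAt m b
... | inj₁ u | inj₁ v = g u v
... | inj₂ u | inj₂ v = h u v
... | inj₁ u | inj₂ w = e u w
... | inj₂ w | inj₁ u = e u w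

delete : ∀ {m} → Graph (suc m) → Fin (suc m) → Graph m
delete g i u v = g (punchIn i u) (punchIn i v)

insertGraph : ∀ {m k} → Graph (suc m) → Fin (suc m) → Graph k →
              List (Fin m × Fin k) → Graph (m ℕ+ k)
insertGraph {m} t1 i t2 f = glue m (delete t1 i) t2 (lookupMap f)

-- partial composition on basis elements of K T : the list of summands
compT : ∀ {m k} → Graph (suc m) → Fin (suc m) → Graph k → List (Graph (m ℕ+ k))
compT {m} {k} t1 i t2 = map (insertGraph t1 i t2) (allMaps k (neighbours t1 i))

reachAvoid : ∀ {n} → Graph n → Fin n → ℕ → Fin n → Fin n → Bool
reachAvoid g x zero    a b = not (a == x) ∧ (a == b)
reachAvoid {n} g x (suc s) a b =
  reachAvoid g x s a b ∨
  any (λ u → reachAvoid g x s a u ∧ g u b ∧ not (b == x)) (allFin n)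

-- u (a vertex of V1 ∖ {*}) is the parent of * in the tree rooted at r:
-- u is adjacent to * and u is connected to r in t ∖ {*}
isParent : ∀ {m} → Graph (suc m) → Fin (suc m) → Fin (suc m) → Fin m → Bool
isParent {m} t r i u = t i (punchIn i u) ∧ reachAvoid t i (suc m) (punchIn i u) r

children : ∀ {m} → Graph (suc m) → Fin (suc m) → Fin (suc m) → List (Fin m)
children t r i = filter (λ u → isParent t r i u Data.Bool.≟ false) (neighbours t i)
  where import Data.Bool

newRoot : ∀ {m k} → Fin (suc m) → Fin (suc m) → Fin k → Fin (m ℕ+ k)
newRoot {m} {k} r1 i r2 with i ≟ r1
... | yes _  = m ↑ʳ r2
... | no i≢r = punchOut i≢r ↑ˡ k

insertRooted : ∀ {m k} → Graph (suc m) × Fin (suc m) → Fin (suc m) →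
               Graph k × Fin k → List (Fin m × Fin k) → Graph (m ℕ+ k) × Fin (m ℕ+ k)
insertRooted {m} (t1 , r1) i (t2 , r2) f =
  glue m (delete t1 i) t2
    (λ u w → lookupMap f u w ∨ (isParent t1 r1 i u ∧ (w == r2)))
  , newRoot r1 i r2

compPL : ∀ {m k} → Graph (suc m) × Fin (suc m) → Fin (suc m) →
         Graph k × Fin k → List (Graph (m ℕ+ k) × Fin (m ℕ+ k))
compPL {m} {k} (t1 , r1) i (t2 , r2) =
  map (insertRooted (t1 , r1) i (t2 , r2)) (allMaps k (children t1 r1 i))

relabel : ∀ {n} → Permutation′ n → Graph n → Graph n
relabel σ g u v = g (σ ⟨$⟩ˡ u) (σ ⟨$⟩ˡ v)

relabelR : ∀ {n} → Permutation′ n → Graph n × Fin n → Graph n × Fin n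
relabelR σ (g , r) = relabel σ g , σ ⟨$⟩ʳ r

unitT : Graph 1
unitT _ _ = false

unitPL : Graph 1 × Fin 1
unitPL = unitT , zero

-- Linear combinations over K (formal sums, compared coefficientwise)

module Linear {c ℓ} (K : Field c ℓ) where
  open Field K

  LC : Set → Set c
  LC B = List (Carrier × B)

  coeff : ∀ {B : Set} → (B → B → Bool) → LC B → B → Carrier
  coeff eq x s = foldr (λ p acc → (if eq (proj₂ p) s then proj₁ p else 0#) + acc) 0# x

  _≋T_ : ∀ {n} → LC (Graph n) → LC (Graph n) → Set ℓ
  x ≋T y = ∀ s → coeff eqGraph x s ≈ coeff eqGraph y s

  _≋PL_ : ∀ {n} → LC (Graph n × Fin n) → LC (Graph n × Fin n) → Set ℓ
  x ≋PL y = ∀ s → coeff eqRooted x s ≈ coeff eqRooted y s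

  InKT : ∀ {n} → LC (Graph n) → Set c
  InKT x = All (λ p → IsTree (proj₂ p)) x

  InPL : ∀ {n} → LC (Graph n × Fin n) → Set c
  InPL x = All (λ p → IsTree (proj₁ (proj₂ p))) x

  bilin : ∀ {A B C : Set} → (A → B → List C) → LC A → LC B → LC C
  bilin op x y =
    concatMap (λ p → concatMap (λ q →
      map (λ t → (proj₁ p * proj₁ q , t)) (op (proj₂ p) (proj₂ q))) y) x

  _∘T[_]_ : ∀ {m k} → LC (Graph (suc m)) → Fin (suc m) → LC (Graph k) → LC (Graph (m ℕ+ k))
  x ∘T[ i ] y = bilin (λ t1 t2 → compT t1 i t2) x y

  _∘PL[_]_ : ∀ {m k} → LC (Graph (suc m) × Fin (suc m)) → Fin (suc m) →
             LC (Graph k × Fin k) → LC (Graph (m ℕ+ k) × Fin (m ℕ+ k))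
  x ∘PL[ i ] y = bilin (λ t1 t2 → compPL t1 i t2) x y

  actT : ∀ {n} → Permutation′ n → LC (Graph n) → LC (Graph n)
  actT σ = map (λ p → proj₁ p , relabel σ (proj₂ p))

  actPL : ∀ {n} → Permutation′ n → LC (Graph n × Fin n) → LC (Graph n × Fin n)
  actPL σ = map (λ p → proj₁ p , relabelR σ (proj₂ p))

  ψ : ∀ {n} → LC (Graph n) → LC (Graph n × Fin n)
  ψ {n} = concatMap (λ p → map (λ r → proj₁ p , (proj₂ p , r)) (allFin n))

module Submission where

-- The coefficient of a rooted tree (G , ρ) in ψ x is the coefficient of G in x, whatever ρ is;
-- this gives well-definedness, injectivity and equivariance at once.
--
-- For compositions one compares multiplicities: a summand G of t₁ ∘∗ t₂ occurs, with a prescribed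
-- root ρ, as often in ψ t₁ ∘∗ ψ t₂ (summed over the roots r₁ , r₂) as it occurs in t₁ ∘∗ t₂.
-- If ρ ∈ V₂, only r₁ = ∗ and r₂ = ρ contribute; then ∗ has no parent and all its neighbours are
-- children, so both sides count the same maps.  If ρ ∈ V₁ ∖ {∗}, only r₁ = ρ contributes, and ∗
-- has a unique parent p in (t₁ , ρ): it exists because t₁ is connected and is unique because t₁
-- is acyclic.  A map on the children of ∗ together with the edge from p to r₂ is then the same as
-- a map on all neighbours of ∗ sending p to r₂, so summing over r₂ gives the count for t₁ ∘∗ t₂.

open import Level using (Level; 0ℓ)
open import Algebra.Bundles using (CommutativeMonoid)
open import Data.Nat using (ℕ; zero; suc; _≤_; z≤n; s≤s; _<?_) renaming (_+_ to _ℕ+_)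
open import Data.Nat.Properties using (≮⇒≥; m≤n⇒m≤1+n; +-0-commutativeMonoid)
open import Data.Fin using (Fin; zero; suc; _≟_; join; punchIn; punchOut; splitAt; _↑ˡ_; _↑ʳ_)
open import Data.Fin.Properties
  using (suc-injective; pigeonhole; <⇒≢; punchIn-punchOut; punchIn-injective; punchOut-punchIn;
         punchOut-cong; punchInᵢ≢i; splitAt-↑ˡ; splitAt-↑ʳ; join-splitAt; ↑ˡ-injective; ↑ʳ-injective)
open import Data.Fin.Permutation using (Permutation′; _⟨$⟩ʳ_; _⟨$⟩ˡ_; inverseˡ; inverseʳ)
open import Data.Bool using (Bool; true; false; _∧_; _∨_; not; if_then_else_)
import Data.Bool as Bool
open import Data.Bool.ListAction using (any; and)
open import Data.Bool.Properties using (∧-identityʳ; ∧-zeroʳ; ∨-zeroʳ; ∨-assoc; ∨-comm; ∨-commutativeMonoid)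
open import Data.List using (List; []; _∷_; _++_; [_]; length; lookup; map; concatMap; filter)
open import Data.List.Properties using (map-cong; filter-all; filter-accept; filter-reject)
open import Data.List.Relation.Unary.All as All using (All; []; _∷_)
import Data.List.Relation.Unary.All.Properties as AllP
open import Data.List.Relation.Unary.All.Properties using (¬Any⇒All¬; All¬⇒¬Any)
open import Data.List.Relation.Unary.Any using (here; there)
open import Data.List.Relation.Unary.AllPairs using ([]; _∷_)
open import Data.List.Relation.Unary.Linked using (Linked; [-]; _∷_)
open import Data.List.Relation.Unary.Unique.Propositional using (Unique)
import Data.List.Relation.Unary.Unique.Propositional.Properties as UniqueP
open import Data.List.Membership.Propositional using (_∈_; _∉_)
open import Data.List.Membership.Propositional.Properties using (∈-lookup; ∈-map⁺; ∈-filter⁺)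
open import Data.List.Relation.Binary.Subset.Propositional using (_⊆_)
open import Data.Product using (_×_; _,_; Σ; proj₁; proj₂; ∃-syntax)
open import Data.Sum using (_⊎_; inj₁; inj₂)
open import Function using (id; _∘_)
open import Relation.Unary using (Pred; Decidable)
open import Relation.Binary using (Rel; DecidableEquality; Symmetric)
open import Relation.Binary.PropositionalEquality as ≡ using (_≡_; _≢_; refl; cong; cong₂)
open import Relation.Nullary using (¬_; Dec; yes; no; does; contradiction)
open import Relation.Nullary.Decidable using (dec-true; dec-false)
open import Defs

module ListSum {c ℓ} (M : CommutativeMonoid c ℓ) where
  open CommutativeMonoid M renaming (refl to ≈-refl)
  open import Algebra.Properties.CommutativeSemigroup commutativeSemigroup using (interchange)
  open import Relation.Binary.Reasoning.Setoid setoid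

  private variable
    a b : Level
    A : Set a
    B : Set b

  ∑ : List A → (A → Carrier) → Carrier
  ∑ []       f = ε
  ∑ (x ∷ xs) f = f x ∙ ∑ xs f

  ∑-cong : ∀ (xs : List A) {f g : A → Carrier} → (∀ x → f x ≈ g x) → ∑ xs f ≈ ∑ xs g
  ∑-cong []       f≈g = ≈-refl
  ∑-cong (x ∷ xs) f≈g = ∙-cong (f≈g x) (∑-cong xs f≈g)

  ∑-cong-All : ∀ {p} {P : A → Set p} {xs : List A} {f g : A → Carrier} →
              All P xs → (∀ {x} → P x → f x ≈ g x) → ∑ xs f ≈ ∑ xs g
  ∑-cong-All []         f≈g = ≈-refl
  ∑-cong-All (px ∷ pxs) f≈g = ∙-cong (f≈g px) (∑-cong-All pxs f≈g)

  ∑-ε : ∀ (xs : List A) {f : A → Carrier} → (∀ x → f x ≈ ε) → ∑ xs f ≈ ε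
  ∑-ε []       f≈ε = ≈-refl
  ∑-ε (x ∷ xs) f≈ε = trans (∙-cong (f≈ε x) (∑-ε xs f≈ε)) (identityˡ ε)

  ∑-++ : ∀ (xs ys : List A) (f : A → Carrier) → ∑ (xs ++ ys) f ≈ ∑ xs f ∙ ∑ ys f
  ∑-++ []       ys f = sym (identityˡ _)
  ∑-++ (x ∷ xs) ys f = trans (∙-cong ≈-refl (∑-++ xs ys f)) (sym (assoc _ _ _))

  ∑-map : ∀ (h : A → B) (xs : List A) (f : B → Carrier) → ∑ (map h xs) f ≈ ∑ xs (λ x → f (h x))
  ∑-map h []       f = ≈-refl
  ∑-map h (x ∷ xs) f = ∙-cong ≈-refl (∑-map h xs f)

  ∑-concatMap : ∀ (h : A → List B) (xs : List A) (f : B → Carrier) →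
                ∑ (concatMap h xs) f ≈ ∑ xs (λ x → ∑ (h x) f)
  ∑-concatMap h []       f = ≈-refl
  ∑-concatMap h (x ∷ xs) f = trans (∑-++ (h x) _ f) (∙-cong ≈-refl (∑-concatMap h xs f))

  ∑-∙ : ∀ (xs : List A) (f g : A → Carrier) → ∑ xs (λ x → f x ∙ g x) ≈ ∑ xs f ∙ ∑ xs g
  ∑-∙ []       f g = sym (identityˡ ε)
  ∑-∙ (x ∷ xs) f g = trans (∙-cong ≈-refl (∑-∙ xs f g)) (interchange _ _ _ _)

  ∑-comm : ∀ (xs : List A) (ys : List B) (f : A → B → Carrier) →
           ∑ xs (λ x → ∑ ys (f x)) ≈ ∑ ys (λ y → ∑ xs (λ x → f x y))
  ∑-comm []       ys f = sym (∑-ε ys (λ _ → ≈-refl))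
  ∑-comm (x ∷ xs) ys f = begin
    ∑ ys (f x) ∙ ∑ xs (λ x → ∑ ys (f x))   ≈⟨ ∙-cong ≈-refl (∑-comm xs ys f) ⟩
    ∑ ys (f x) ∙ ∑ ys (λ y → ∑ xs (λ x → f x y)) ≈⟨ ∑-∙ ys (f x) _ ⟨
    ∑ ys (λ y → f x y ∙ ∑ xs (λ x → f x y)) ∎

  ∑-allFin-single : ∀ {n} (ρ : Fin n) (f : Fin n → Carrier) →
                    (∀ r → r ≢ ρ → f r ≈ ε) → ∑ (allFin n) f ≈ f ρ
  ∑-allFin-single {suc n} ρ f off = trans (∙-cong ≈-refl (∑-map suc (allFin n) f)) (split ρ off)
    where
    split : ∀ ρ → (∀ r → r ≢ ρ → f r ≈ ε) → f zero ∙ ∑ (allFin n) (λ r → f (suc r)) ≈ f ρ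
    split zero    off = trans (∙-cong ≈-refl (∑-ε (allFin n) (λ r → off (suc r) λ ()))) (identityʳ _)
    split (suc ρ) off = trans (∙-cong (off zero λ ()) ≈-refl) (trans (identityˡ _)
      (∑-allFin-single ρ (λ r → f (suc r)) (λ r r≢ρ → off (suc r) (r≢ρ ∘ suc-injective))))

∧-true : ∀ {x y} → x ∧ y ≡ true → x ≡ true × y ≡ true
∧-true {true} {true} _ = refl , refl

∧-intro : ∀ {x y} → x ≡ true → y ≡ true → x ∧ y ≡ true
∧-intro refl refl = refl

∨-true : ∀ {x y} → x ∨ y ≡ true → x ≡ true ⊎ y ≡ true
∨-true {true}  _   = inj₁ refl
∨-true {false} y≡t = inj₂ y≡t

∨-introˡ : ∀ {x y} → x ≡ true → x ∨ y ≡ true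
∨-introˡ refl = refl

∨-introʳ : ∀ {x y} → y ≡ true → x ∨ y ≡ true
∨-introʳ {x} refl = ∨-zeroʳ x

any-true : ∀ {A : Set} {f : A → Bool} xs → any f xs ≡ true → ∃[ x ] f x ≡ true
any-true {f = f} (x ∷ xs) any≡t with ∨-true {f x} any≡t
... | inj₁ fx≡t = x , fx≡t
... | inj₂ rest = any-true xs rest

any-intro : ∀ {A : Set} (f : A → Bool) {x xs} → x ∈ xs → f x ≡ true → any f xs ≡ true
any-intro f (here refl)  fx≡t = ∨-introˡ fx≡t
any-intro f (there x∈xs) fx≡t = ∨-introʳ (any-intro f x∈xs fx≡t)

∈-allFin : ∀ {n} (a : Fin n) → a ∈ allFin n
∈-allFin zero    = here refl
∈-allFin (suc a) = there (∈-map⁺ suc (∈-allFin a))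

allFin-unique : ∀ n → Unique (allFin n)
allFin-unique zero    = []
allFin-unique (suc n) = AllP.map⁺ (All.tabulate (λ _ ())) ∷ UniqueP.map⁺ suc-injective (allFin-unique n)

==-refl : ∀ {n} (a : Fin n) → (a == a) ≡ true
==-refl a = dec-true (a ≟ a) refl

==-≢ : ∀ {n} {a b : Fin n} → a ≢ b → (a == b) ≡ false
==-≢ {a = a} {b} = dec-false (a ≟ b)

==⇒≡ : ∀ {n} {a b : Fin n} → (a == b) ≡ true → a ≡ b
==⇒≡ {a = a} {b} eq with a ≟ b
... | yes a≡b = a≡b

==-sym : ∀ {n} (a b : Fin n) → (a == b) ≡ (b == a)
==-sym a b with a ≟ b
... | yes refl = ≡.sym (==-refl a)
... | no  a≢b  = ≡.sym (==-≢ (a≢b ∘ ≡.sym))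

not-==⇒≢ : ∀ {n} {a b : Fin n} → not (a == b) ≡ true → a ≢ b
not-==⇒≢ {a = a} nab refl rewrite ==-refl a = contradiction nab λ ()

≢⇒not-== : ∀ {n} {a b : Fin n} → a ≢ b → not (a == b) ≡ true
≢⇒not-== a≢b rewrite ==-≢ a≢b = refl

-- Simple walks

lookup-injective : ∀ {A : Set} {xs : List A} → Unique xs → ∀ {i j} → lookup xs i ≡ lookup xs j → i ≡ j
lookup-injective {xs = x ∷ xs} (x∉ ∷ u) {zero}  {zero}  eq = refl
lookup-injective {xs = x ∷ xs} (x∉ ∷ u) {zero}  {suc j} eq =
  contradiction eq (All.lookup x∉ (∈-lookup j))
lookup-injective {xs = x ∷ xs} (x∉ ∷ u) {suc i} {zero}  eq =
  contradiction (≡.sym eq) (All.lookup x∉ (∈-lookup i))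
lookup-injective {xs = x ∷ xs} (x∉ ∷ u) {suc i} {suc j} eq = ≡.cong suc (lookup-injective u eq)

Unique⇒length≤ : ∀ {n} {xs : List (Fin n)} → Unique xs → length xs ≤ n
Unique⇒length≤ {n} {xs} u with n <? length xs
... | no  n≮len = ≮⇒≥ n≮len
... | yes n<len =
  let (i , j , i<j , eq) = pigeonhole n<len (lookup xs) in
  contradiction (lookup-injective u eq) (<⇒≢ i<j)

module Walks {A : Set} (_≟ᴬ_ : DecidableEquality A) (R : Rel A 0ℓ) where
  open import Data.List.Membership.DecPropositional _≟ᴬ_ using (_∈?_)
  open import Relation.Binary.Construct.Closure.ReflexiveTransitive
    using (Star; ε; _◅_; _◅◅_; revApp; reverse) public

  Walk : A → A → Set
  Walk = Star R

  vertices : ∀ {x y} → Walk x y → List A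
  vertices {x} ε       = x ∷ []
  vertices {x} (_ ◅ w) = x ∷ vertices w

  Simple : ∀ {x y} → Walk x y → Set
  Simple w = Unique (vertices w)

  source-∈-vertices : ∀ {x y} (w : Walk x y) → x ∈ vertices w
  source-∈-vertices ε       = here refl
  source-∈-vertices (_ ◅ _) = here refl

  target-∈-vertices : ∀ {x y} (w : Walk x y) → y ∈ vertices w
  target-∈-vertices ε       = here refl
  target-∈-vertices (_ ◅ w) = there (target-∈-vertices w)

  ∈-vertices-◅◅ : ∀ {x y z a} (w₁ : Walk x y) (w₂ : Walk y z) →
                  a ∈ vertices (w₁ ◅◅ w₂) → a ∈ vertices w₁ ⊎ a ∈ vertices w₂
  ∈-vertices-◅◅ ε        w₂ a∈         = inj₂ a∈
  ∈-vertices-◅◅ (e ◅ w₁) w₂ (here a≡x) = inj₁ (here a≡x)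
  ∈-vertices-◅◅ (e ◅ w₁) w₂ (there a∈) with ∈-vertices-◅◅ w₁ w₂ a∈
  ... | inj₁ a∈w₁ = inj₁ (there a∈w₁)
  ... | inj₂ a∈w₂ = inj₂ a∈w₂

  module _ (sym : Symmetric R) where

    ∈-vertices-revApp : ∀ {x y z a} (w : Walk y x) (acc : Walk y z) →
                        a ∈ vertices (revApp sym w acc) → a ∈ vertices w ⊎ a ∈ vertices acc
    ∈-vertices-revApp ε       acc a∈ = inj₂ a∈
    ∈-vertices-revApp (e ◅ w) acc a∈ with ∈-vertices-revApp w (sym e ◅ acc) a∈
    ... | inj₁ a∈w           = inj₁ (there a∈w)
    ... | inj₂ (here refl)   = inj₁ (there (source-∈-vertices w))
    ... | inj₂ (there a∈acc) = inj₂ a∈acc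

    ∈-vertices-reverse : ∀ {x y a} (w : Walk x y) → a ∈ vertices (reverse sym w) → a ∈ vertices w
    ∈-vertices-reverse w a∈ with ∈-vertices-revApp w ε a∈
    ... | inj₁ a∈w         = a∈w
    ... | inj₂ (here refl) = source-∈-vertices w

  fromLinked : ∀ x ws y → Linked R (x ∷ ws ++ [ y ]) → Walk x y
  fromLinked x []       y (e ∷ [-]) = e ◅ ε
  fromLinked x (w ∷ ws) y (e ∷ l)   = e ◅ fromLinked w ws y l

  linked-vertices : ∀ {x a b y} → R x a → (w : Walk a b) → R b y → Linked R (x ∷ vertices w ++ [ y ])
  linked-vertices e ε        e′ = e ∷ e′ ∷ [-]
  linked-vertices e (e″ ◅ w) e′ = e ∷ linked-vertices e″ w e′

  suffixFrom : ∀ {x y a} (w : Walk x y) → a ∈ vertices w →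
               Σ (Walk a y) λ w′ → vertices w′ ⊆ vertices w × (Simple w → Simple w′)
  suffixFrom ε       (here refl) = ε , (λ a∈ → a∈) , (λ u → u)
  suffixFrom (e ◅ w) (here refl) = e ◅ w , (λ a∈ → a∈) , (λ u → u)
  suffixFrom (e ◅ w) (there a∈) =
    let (w′ , w′⊆w , simple) = suffixFrom w a∈ in
    w′ , there ∘ w′⊆w , λ { (_ ∷ u) → simple u }

  simplify : ∀ {x y} (w : Walk x y) → Σ (Walk x y) λ w′ → Simple w′ × vertices w′ ⊆ vertices w
  simplify ε = ε , [] ∷ [] , λ a∈ → a∈
  simplify {x} (e ◅ w) with simplify w
  ... | w′ , u , w′⊆w with x ∈? vertices w′
  ...   | yes x∈w′ = let (w″ , w″⊆w′ , simple) = suffixFrom w′ x∈w′ in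
                     w″ , simple u , there ∘ w′⊆w ∘ w″⊆w′
  ...   | no  x∉w′ = e ◅ w′ , ¬Any⇒All¬ _ x∉w′ ∷ u ,
                     λ { (here refl) → here refl ; (there a∈) → there (w′⊆w a∈) }

-- Parents in rooted trees

module Reachability {n} (g : Graph n) where
  open Walks _≟_ (Adj g) public

  walkOfPath : ∀ {u v} → Path g u v → Walk u v
  walkOfPath (inj₁ refl)     = ε
  walkOfPath (inj₂ (ws , l)) = fromLinked _ ws _ l

  reach-refl : ∀ {x a} s → a ≢ x → reachAvoid g x s a a ≡ true
  reach-refl {a = a} zero    a≢x rewrite ==-refl a = ∧-intro (≢⇒not-== a≢x) refl
  reach-refl         (suc s) a≢x = ∨-introˡ (reach-refl s a≢x)

  reach-◅ : ∀ {x a b c} s → a ≢ x → Adj g a b → reachAvoid g x s b c ≡ true →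
            reachAvoid g x (suc s) a c ≡ true
  reach-◅ {x} {a} {b} {c} zero a≢x e r with ∧-true r
  ... | c≢x , b==c with ==⇒≡ {a = b} {c} b==c
  ... | refl = ∨-introʳ (any-intro (λ u → reachAvoid g x 0 a u ∧ g u b ∧ not (b == x)) (∈-allFin a)
                 (∧-intro (reach-refl 0 a≢x) (∧-intro e c≢x)))
  reach-◅ {x} {a} {c = c} (suc s) a≢x e r with ∨-true r
  ... | inj₁ r′ = ∨-introˡ (reach-◅ s a≢x e r′)
  ... | inj₂ r′ with any-true (allFin n) r′
  ...   | u , r″ with ∧-true r″
  ...     | ru , rest = ∨-introʳ (any-intro (λ u → reachAvoid g x (suc s) a u ∧ g u c ∧ not (c == x))
                          (∈-allFin u) (∧-intro (reach-◅ s a≢x e ru) rest))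

  reach-complete : ∀ {x a b} s (w : Walk a b) → x ∉ vertices w → length (vertices w) ≤ suc s →
                   reachAvoid g x s a b ≡ true
  reach-complete s       ε           x∉ _           = reach-refl s (λ { refl → x∉ (here refl) })
  reach-complete zero    (e ◅ ε)     x∉ (s≤s ())
  reach-complete zero    (e ◅ _ ◅ _) x∉ (s≤s ())
  reach-complete (suc s) (e ◅ w)     x∉ (s≤s len≤) =
    reach-◅ s (λ { refl → x∉ (here refl) }) e (reach-complete s w (x∉ ∘ there) len≤)

  reach-sound : ∀ {x a b} s → reachAvoid g x s a b ≡ true → Σ (Walk a b) λ w → x ∉ vertices w
  reach-sound {x} {a} {b} zero r with ∧-true r
  ... | a≢x , a==b with ==⇒≡ {a = a} {b} a==b
  ... | refl = ε , λ { (here refl) → not-==⇒≢ {a = a} a≢x refl }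
  reach-sound {x} (suc s) r with ∨-true r
  ... | inj₁ r′ = reach-sound s r′
  ... | inj₂ r′ with any-true (allFin n) r′
  ...   | u , r″ with ∧-true r″
  ...     | ru , rest with ∧-true rest | reach-sound s ru
  ...       | e , b≢x | w , x∉w = w ◅◅ (e ◅ ε) , avoid
    where
    avoid : _ ∉ vertices (w ◅◅ (e ◅ ε))
    avoid x∈ with ∈-vertices-◅◅ w (e ◅ ε) x∈
    ... | inj₁ x∈w                 = x∉w x∈w
    ... | inj₂ (here refl)         = x∉w (target-∈-vertices w)
    ... | inj₂ (there (here refl)) = not-==⇒≢ {a = x} b≢x refl

  reach-avoided : ∀ {x a} s → reachAvoid g x s a x ≡ false
  reach-avoided {x} {a} s with reachAvoid g x s a x in r
  ... | false = refl
  ... | true  = let (w , x∉w) = reach-sound s r in contradiction (target-∈-vertices w) x∉w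

  cycleOfWalk : ∀ {i u u′} → Adj g i u → Adj g u′ i → u ≢ u′ →
                (w : Walk u u′) → Simple w → i ∉ vertices w → Cycle g
  cycleOfWalk {i} e e′ u≢u′ w simple i∉w =
    i , vertices w , two≤ w , ¬Any⇒All¬ _ i∉w ∷ simple , linked-vertices e w e′
    where
    two≤ : (w : Walk _ _) → 2 ≤ length (vertices w)
    two≤ ε           = contradiction refl u≢u′
    two≤ (_ ◅ ε)     = s≤s (s≤s z≤n)
    two≤ (_ ◅ _ ◅ _) = s≤s (s≤s z≤n)

isParent-root : ∀ {m} (t : Graph (suc m)) i u → isParent t i i u ≡ false
isParent-root {m} t i u rewrite Reachability.reach-avoided t {i} {punchIn i u} (suc m) = ∧-zeroʳ _

module TreeParent {m} {t : Graph (suc m)} (tree : IsTree t) where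
  open IsTree tree
  open Reachability t

  adj⇒≢ : ∀ {a b} → Adj t a b → a ≢ b
  adj⇒≢ {a} e refl = contradiction (≡.trans (≡.sym e) (irreflexive a)) λ ()

  adj-sym : Symmetric (Adj t)
  adj-sym {a} {b} e = ≡.trans (symmetric b a) e

  parent-exists : ∀ {i r} → i ≢ r → ∃[ p ] isParent t r i p ≡ true
  parent-exists {i} {r} i≢r with simplify (walkOfPath (connected i r))
  ... | ε , _ , _ = contradiction refl i≢r
  ... | _◅_ {j = u} e w , i∉w ∷ simple , _ with Unique⇒length≤ (i∉w ∷ simple)
  ...   | s≤s len≤m =
    -- the simple walk has at most suc m vertices, so reachAvoid sees its tail within suc m steps
    punchOut (adj⇒≢ e) ,
    ≡.subst (λ v → t i v ∧ reachAvoid t i (suc m) v r ≡ true) (≡.sym (punchIn-punchOut (adj⇒≢ e)))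
      (∧-intro e (reach-complete (suc m) w (All¬⇒¬Any i∉w) (m≤n⇒m≤1+n (m≤n⇒m≤1+n len≤m))))

  parent-unique : ∀ {i r p p′} → isParent t r i p ≡ true → isParent t r i p′ ≡ true → p ≡ p′
  parent-unique {i} {r} {p} {p′} par par′ with ∧-true par | ∧-true par′
  ... | e , reach | e′ , reach′ with reach-sound (suc m) reach | reach-sound (suc m) reach′
  ...   | w , i∉w | w′ , i∉w′ with punchIn i p ≟ punchIn i p′
  ...     | yes u≡u′ = punchIn-injective i p p′ u≡u′
  ...     | no  u≢u′ =
    let (w″ , simple , w″⊆) = simplify (w ◅◅ reverse adj-sym w′) in
    contradiction (cycleOfWalk e (adj-sym e′) u≢u′ w″ simple (avoid ∘ w″⊆)) acyclic
    where
    avoid : i ∉ vertices (w ◅◅ reverse adj-sym w′)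
    avoid i∈ with ∈-vertices-◅◅ w (reverse adj-sym w′) i∈
    ... | inj₁ i∈w  = i∉w i∈w
    ... | inj₂ i∈w′ = i∉w′ (∈-vertices-reverse adj-sym w′ i∈w′)

  parentOf : ∀ {i r} → i ≢ r → ∃[ p ] ∀ u → isParent t r i u ≡ (p == u)
  parentOf {i} {r} i≢r with parent-exists i≢r
  ... | p , par = p , is-p
    where
    is-p : ∀ u → isParent t r i u ≡ (p == u)
    is-p u with p ≟ u
    ... | yes refl = par
    ... | no  p≢u with isParent t r i u in par′
    ...   | true  = contradiction (parent-unique par par′) p≢u
    ...   | false = refl

-- Counting the summands of a partial composition

module ℕSum = ListSum +-0-commutativeMonoid
open ℕSum using () renaming (∑ to ∑ℕ)

count : ∀ {A : Set} → (A → Bool) → List A → ℕ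
count P xs = ∑ℕ xs (λ x → if P x then 1 else 0)

count-cong : ∀ {A : Set} {P P′ : A → Bool} xs → (∀ x → P x ≡ P′ x) → count P xs ≡ count P′ xs
count-cong xs P≡P′ = ℕSum.∑-cong xs (λ x → cong (if_then 1 else 0) (P≡P′ x))

count-∧ : ∀ {A : Set} (P : A → Bool) b xs → count (λ x → P x ∧ b) xs ≡ (if b then count P xs else 0)
count-∧ P true  xs = count-cong xs (λ x → ∧-identityʳ (P x))
count-∧ P false xs = ℕSum.∑-ε xs (λ x → cong (if_then 1 else 0) (∧-zeroʳ (P x)))

Edges : ℕ → ℕ → Set
Edges m k = Fin m → Fin k → Bool

∅ : ∀ {m k} → Edges m k
∅ _ _ = false

_∪_ : ∀ {m k} → Edges m k → Edges m k → Edges m k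
(e ∪ e′) u w = e u w ∨ e′ u w

-- oriented as in lookupMap, so that lookupMap ((a , w) ∷ f) is definitionally edge a w ∪ lookupMap f
edge : ∀ {m k} → Fin m → Fin k → Edges m k
edge a w u w′ = (a == u) ∧ (w == w′)

_≐_ : ∀ {m k} → Edges m k → Edges m k → Set
e ≐ e′ = ∀ u w → e u w ≡ e′ u w

module MapCount {m k} (Q : Edges m k → Bool)
                (Q-ext : ∀ {e e′} → e ≐ e′ → Q e ≡ Q e′) where
  open ≡.≡-Reasoning

  #maps : List (Fin m) → Edges m k → ℕ
  #maps L b = count (λ f → Q (b ∪ lookupMap f)) (allMaps k L)

  #maps-cong : ∀ L {b b′} → b ≐ b′ → #maps L b ≡ #maps L b′
  #maps-cong L b≐b′ =
    count-cong (allMaps k L) (λ f → Q-ext (λ u w → cong (_∨ lookupMap f u w) (b≐b′ u w)))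

  #maps-∷ : ∀ a L b → #maps (a ∷ L) b ≡ ∑ℕ (allFin k) (λ w → #maps L (b ∪ edge a w))
  #maps-∷ a L b = begin
    #maps (a ∷ L) b
      ≡⟨ ℕSum.∑-concatMap (λ w → map ((a , w) ∷_) (allMaps k L)) (allFin k) _ ⟩
    ∑ℕ (allFin k) (λ w → count (λ f → Q (b ∪ lookupMap f)) (map ((a , w) ∷_) (allMaps k L)))
      ≡⟨ ℕSum.∑-cong (allFin k) (λ w → ≡.trans (ℕSum.∑-map ((a , w) ∷_) (allMaps k L) _)
           (count-cong (allMaps k L) (λ f → Q-ext (λ u w′ → ≡.sym (∨-assoc (b u w′) _ _))))) ⟩
    ∑ℕ (allFin k) (λ w → #maps L (b ∪ edge a w)) ∎

  module _ {ℓ} {P : Pred (Fin m) ℓ} (P? : Decidable P) {p : Fin m}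
           (¬Pp : ¬ P p) (P-≢ : ∀ {u} → u ≢ p → P u) where

    #maps-extract : ∀ {L} → Unique L → p ∈ L → ∀ b →
                    #maps L b ≡ ∑ℕ (allFin k) (λ w → #maps (filter P? L) (b ∪ edge p w))
    #maps-extract {a ∷ L} (a∉L ∷ _) (here refl) b =
      ≡.trans (#maps-∷ p L b)
              (ℕSum.∑-cong (allFin k) (λ w → cong (λ L′ → #maps L′ (b ∪ edge p w)) (≡.sym rest)))
      where
      rest : filter P? (p ∷ L) ≡ L
      rest = ≡.trans (filter-reject P? ¬Pp) (filter-all P? (All.map (λ p≢u → P-≢ (p≢u ∘ ≡.sym)) a∉L))
    #maps-extract {a ∷ L} (a∉L ∷ unique) (there p∈L) b = begin
      #maps (a ∷ L) b
        ≡⟨ #maps-∷ a L b ⟩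
      ∑ℕ (allFin k) (λ w′ → #maps L (b ∪ edge a w′))
        ≡⟨ ℕSum.∑-cong (allFin k) (λ w′ → #maps-extract unique p∈L _) ⟩
      ∑ℕ (allFin k) (λ w′ → ∑ℕ (allFin k) (λ w → #maps (filter P? L) ((b ∪ edge a w′) ∪ edge p w)))
        ≡⟨ ℕSum.∑-comm (allFin k) (allFin k) _ ⟩
      ∑ℕ (allFin k) (λ w → ∑ℕ (allFin k) (λ w′ → #maps (filter P? L) ((b ∪ edge a w′) ∪ edge p w)))
        ≡⟨ ℕSum.∑-cong (allFin k) (λ w → ℕSum.∑-cong (allFin k) (λ w′ →
             #maps-cong (filter P? L) (λ u v → xy∙z≈xz∙y (b u v) _ _))) ⟩
      ∑ℕ (allFin k) (λ w → ∑ℕ (allFin k) (λ w′ → #maps (filter P? L) ((b ∪ edge p w) ∪ edge a w′)))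
        ≡⟨ ℕSum.∑-cong (allFin k) (λ w → ≡.sym (#maps-∷ a (filter P? L) _)) ⟩
      ∑ℕ (allFin k) (λ w → #maps (a ∷ filter P? L) (b ∪ edge p w))
        ≡⟨ ℕSum.∑-cong (allFin k) (λ w → cong (λ L′ → #maps L′ (b ∪ edge p w))
             (≡.sym (filter-accept P? (P-≢ (All.lookup a∉L p∈L))))) ⟩
      ∑ℕ (allFin k) (λ w → #maps (filter P? (a ∷ L)) (b ∪ edge p w)) ∎
      where
      open import Algebra.Properties.CommutativeSemigroup
        (CommutativeMonoid.commutativeSemigroup ∨-commutativeMonoid) using (xy∙z≈xz∙y)

eqGraph-ext : ∀ {n} {g g′ : Graph n} (G : Graph n) → (∀ a b → g a b ≡ g′ a b) →
              eqGraph g G ≡ eqGraph g′ G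
eqGraph-ext {n} G g≡g′ = cong and (map-cong (λ u → cong and (map-cong (λ v →
  cong (λ x → does (x Bool.≟ G u v)) (g≡g′ u v)) (allFin n))) (allFin n))

glue-ext : ∀ m {k} (g : Graph m) (h : Graph k) {e e′ : Edges m k} → e ≐ e′ →
           ∀ a b → glue m g h e a b ≡ glue m g h e′ a b
glue-ext m g h e≐e′ a b with splitAt m a | splitAt m b
... | inj₁ u | inj₁ v = refl
... | inj₂ u | inj₂ v = refl
... | inj₁ u | inj₂ w = e≐e′ u w
... | inj₂ w | inj₁ u = e≐e′ u w

↑ˡ≢↑ʳ : ∀ {m k} (u : Fin m) (w : Fin k) → u ↑ˡ k ≢ m ↑ʳ w
↑ˡ≢↑ʳ {m} {k} u w eq
  with ≡.trans (≡.sym (splitAt-↑ˡ m u k)) (≡.trans (cong (splitAt m) eq) (splitAt-↑ʳ m k w))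
... | ()

module _ {m k : ℕ} (i : Fin (suc m)) where

  newRoot-root : ∀ (r₂ : Fin k) → newRoot i i r₂ ≡ m ↑ʳ r₂
  newRoot-root r₂ with i ≟ i
  ... | yes _   = refl
  ... | no  i≢i = contradiction refl i≢i

  newRoot-nonroot : ∀ {r₁} (r₂ : Fin k) (i≢r₁ : i ≢ r₁) → newRoot r₁ i r₂ ≡ punchOut i≢r₁ ↑ˡ k
  newRoot-nonroot {r₁} r₂ i≢r₁ with i ≟ r₁
  ... | yes i≡r₁ = contradiction i≡r₁ i≢r₁
  ... | no  _    = cong (_↑ˡ k) (punchOut-cong i refl)

  newRoot-punchIn : ∀ v (r₂ : Fin k) → newRoot (punchIn i v) i r₂ ≡ v ↑ˡ k
  newRoot-punchIn v r₂ = ≡.trans (newRoot-nonroot r₂ (punchInᵢ≢i i v ∘ ≡.sym))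
                                 (cong (_↑ˡ k) (punchOut-punchIn i))

  newRoot≡↑ʳ : ∀ {r₁} {r₂ w : Fin k} → newRoot r₁ i r₂ ≡ m ↑ʳ w → r₁ ≡ i × r₂ ≡ w
  newRoot≡↑ʳ {r₁} {r₂} {w} eq with i ≟ r₁
  ... | yes refl = refl , ↑ʳ-injective m r₂ w eq
  ... | no  _    = contradiction eq (↑ˡ≢↑ʳ _ w)

  newRoot≡↑ˡ : ∀ {r₁} {r₂ : Fin k} {v} → newRoot r₁ i r₂ ≡ v ↑ˡ k → r₁ ≡ punchIn i v
  newRoot≡↑ˡ {r₁} {r₂} {v} eq with i ≟ r₁
  ... | yes refl = contradiction (≡.sym eq) (↑ˡ≢↑ʳ v r₂)
  ... | no  i≢r₁ = ≡.trans (≡.sym (punchIn-punchOut i≢r₁)) (cong (punchIn i) (↑ˡ-injective k _ v eq))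

module CompositionCount {m k} (i : Fin (suc m)) (t₁ : Graph (suc m)) (t₂ : Graph k)
                        (G : Graph (m ℕ+ k)) where
  open ≡.≡-Reasoning
  open MapCount (λ e → eqGraph (glue m (delete t₁ i) t₂ e) G)
                (λ e≐e′ → eqGraph-ext G (glue-ext m _ t₂ e≐e′))

  multT : ℕ
  multT = count (λ g → eqGraph g G) (compT t₁ i t₂)

  multPL : Fin (suc m) → Fin k → Fin (m ℕ+ k) → ℕ
  multPL r₁ r₂ ρ = count (λ q → eqRooted q (G , ρ)) (compPL (t₁ , r₁) i (t₂ , r₂))

  parentEdge : Fin (suc m) → Fin k → Edges m k
  parentEdge r₁ r₂ u w = isParent t₁ r₁ i u ∧ (w == r₂)

  multT≡#maps : multT ≡ #maps (neighbours t₁ i) ∅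
  multT≡#maps = ℕSum.∑-map (insertGraph t₁ i t₂) (allMaps k (neighbours t₁ i)) _

  multPL≡ : ∀ r₁ r₂ ρ → multPL r₁ r₂ ρ ≡
            (if newRoot r₁ i r₂ == ρ then #maps (children t₁ r₁ i) (parentEdge r₁ r₂) else 0)
  multPL≡ r₁ r₂ ρ = begin
    multPL r₁ r₂ ρ
      ≡⟨ ℕSum.∑-map (insertRooted (t₁ , r₁) i (t₂ , r₂)) (allMaps k (children t₁ r₁ i)) _ ⟩
    count (λ f → eqGraph (glue m (delete t₁ i) t₂ (lookupMap f ∪ parentEdge r₁ r₂)) G
                   ∧ (newRoot r₁ i r₂ == ρ))
          (allMaps k (children t₁ r₁ i))
      ≡⟨ count-∧ _ (newRoot r₁ i r₂ == ρ) (allMaps k (children t₁ r₁ i)) ⟩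
    (if newRoot r₁ i r₂ == ρ
       then count (λ f → eqGraph (glue m (delete t₁ i) t₂ (lookupMap f ∪ parentEdge r₁ r₂)) G)
                  (allMaps k (children t₁ r₁ i))
       else 0)
      ≡⟨ cong (λ n → if newRoot r₁ i r₂ == ρ then n else 0)
           (count-cong (allMaps k (children t₁ r₁ i)) (λ f →
              eqGraph-ext G (glue-ext m _ t₂ (λ u w → ∨-comm (lookupMap f u w) _)))) ⟩
    (if newRoot r₁ i r₂ == ρ then #maps (children t₁ r₁ i) (parentEdge r₁ r₂) else 0) ∎

  multPL-off : ∀ {r₁ r₂ ρ} → newRoot r₁ i r₂ ≢ ρ → multPL r₁ r₂ ρ ≡ 0
  multPL-off {r₁} {r₂} {ρ} ≢ρ rewrite multPL≡ r₁ r₂ ρ | ==-≢ ≢ρ = refl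

  multPL-on : ∀ {r₁ r₂ ρ} → newRoot r₁ i r₂ ≡ ρ →
              multPL r₁ r₂ ρ ≡ #maps (children t₁ r₁ i) (parentEdge r₁ r₂)
  multPL-on {r₁} {r₂} refl rewrite multPL≡ r₁ r₂ (newRoot r₁ i r₂) | ==-refl (newRoot r₁ i r₂) = refl

  multψ : Fin (m ℕ+ k) → ℕ
  multψ ρ = ∑ℕ (allFin (suc m)) (λ r₁ → ∑ℕ (allFin k) (λ r₂ → multPL r₁ r₂ ρ))

  multψ-↑ʳ : ∀ w → multψ (m ↑ʳ w) ≡ multT
  multψ-↑ʳ w = begin
    multψ (m ↑ʳ w)
      ≡⟨ ℕSum.∑-allFin-single i _ (λ r₁ r₁≢i →
           ℕSum.∑-ε (allFin k) (λ r₂ → multPL-off (r₁≢i ∘ proj₁ ∘ newRoot≡↑ʳ i))) ⟩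
    ∑ℕ (allFin k) (λ r₂ → multPL i r₂ (m ↑ʳ w))
      ≡⟨ ℕSum.∑-allFin-single w _ (λ r₂ r₂≢w → multPL-off (r₂≢w ∘ proj₂ ∘ newRoot≡↑ʳ i)) ⟩
    multPL i w (m ↑ʳ w)
      ≡⟨ multPL-on (newRoot-root i w) ⟩
    #maps (children t₁ i i) (parentEdge i w)
      ≡⟨ cong (λ L → #maps L (parentEdge i w)) children-root ⟩
    #maps (neighbours t₁ i) (parentEdge i w)
      ≡⟨ #maps-cong (neighbours t₁ i) (λ u w′ → cong (_∧ (w′ == w)) (isParent-root t₁ i u)) ⟩
    #maps (neighbours t₁ i) ∅
      ≡⟨ multT≡#maps ⟨
    multT ∎
    where
    children-root : children t₁ i i ≡ neighbours t₁ i
    children-root = filter-all _ (All.tabulate (λ {u} _ → isParent-root t₁ i u))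

  module _ (tree : IsTree t₁) where

    multψ-↑ˡ : ∀ v → multψ (v ↑ˡ k) ≡ multT
    multψ-↑ˡ v = begin
      multψ (v ↑ˡ k)
        ≡⟨ ℕSum.∑-allFin-single r _ (λ r₁ r₁≢r →
             ℕSum.∑-ε (allFin k) (λ r₂ → multPL-off (r₁≢r ∘ newRoot≡↑ˡ i))) ⟩
      ∑ℕ (allFin k) (λ r₂ → multPL r r₂ (v ↑ˡ k))
        ≡⟨ ℕSum.∑-cong (allFin k) (λ r₂ → multPL-on (newRoot-punchIn i v r₂)) ⟩
      ∑ℕ (allFin k) (λ r₂ → #maps (children t₁ r i) (parentEdge r r₂))
        ≡⟨ ℕSum.∑-cong (allFin k) (λ r₂ → #maps-cong (children t₁ r i) (λ u w →
             cong₂ _∧_ (isParent≡ u) (==-sym w r₂))) ⟩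
      ∑ℕ (allFin k) (λ r₂ → #maps (children t₁ r i) (∅ ∪ edge p r₂))
        ≡⟨ #maps-extract (λ u → isParent t₁ r i u Bool.≟ false) ¬child-p child-≢p
             (UniqueP.filter⁺ isNeighbour? (allFin-unique m)) p∈neighbours ∅ ⟨
      #maps (neighbours t₁ i) ∅
        ≡⟨ multT≡#maps ⟨
      multT ∎
      where
      r : Fin (suc m)
      r = punchIn i v

      parent : ∃[ p ] ∀ u → isParent t₁ r i u ≡ (p == u)
      parent = TreeParent.parentOf tree (punchInᵢ≢i i v ∘ ≡.sym)

      p : Fin m
      p = proj₁ parent

      isParent≡ : ∀ u → isParent t₁ r i u ≡ (p == u)
      isParent≡ = proj₂ parent

      ¬child-p : isParent t₁ r i p ≢ false
      ¬child-p eq = contradiction (≡.trans (≡.sym (≡.trans (isParent≡ p) (==-refl p))) eq) λ ()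

      child-≢p : ∀ {u} → u ≢ p → isParent t₁ r i u ≡ false
      child-≢p u≢p = ≡.trans (isParent≡ _) (==-≢ (u≢p ∘ ≡.sym))

      isNeighbour? : ∀ u → Dec (t₁ i (punchIn i u) ≡ true)
      isNeighbour? u = t₁ i (punchIn i u) Bool.≟ true

      p∈neighbours : p ∈ neighbours t₁ i
      p∈neighbours = ∈-filter⁺ isNeighbour? (∈-allFin p)
                       (proj₁ (∧-true (≡.trans (isParent≡ p) (==-refl p))))

    multT≡multψ : ∀ ρ → multT ≡ multψ ρ
    multT≡multψ ρ = ≡.subst (λ ρ → multT ≡ multψ ρ) (join-splitAt m k ρ) (bySide (splitAt m ρ))
      where
      bySide : ∀ side → multT ≡ multψ (join m k side)
      bySide (inj₁ v) = ≡.sym (multψ-↑ˡ v)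
      bySide (inj₂ w) = ≡.sym (multψ-↑ʳ w)

-- Coefficients over K

module _ {c ℓ} (K : Field c ℓ) where
  open Field K hiding (zero) renaming (refl to ≈-refl)
  open Linear K
  open ListSum +-commutativeMonoid
  open import Relation.Binary.Reasoning.Setoid setoid

  term : ∀ {B : Set} → (B → B → Bool) → B → Carrier × B → Carrier
  term eq s p = if eq (proj₂ p) s then proj₁ p else 0#

  coeff-∑ : ∀ {B : Set} (eq : B → B → Bool) (x : LC B) s → coeff eq x s ≡ ∑ x (term eq s)
  coeff-∑ eq []      s = ≡.refl
  coeff-∑ eq (p ∷ x) s = ≡.cong (term eq s p +_) (coeff-∑ eq x s)

  if-true : ∀ {b} a → b ≡ true → (if b then a else 0#) ≈ a
  if-true a ≡.refl = ≈-refl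

  if-false : ∀ {b} a → b ≡ false → (if b then a else 0#) ≈ 0#
  if-false a ≡.refl = ≈-refl

  fromℕ-+ : ∀ m n → fromℕ K (m ℕ+ n) ≈ fromℕ K m + fromℕ K n
  fromℕ-+ zero    n = sym (+-identityˡ _)
  fromℕ-+ (suc m) n = trans (+-cong ≈-refl (fromℕ-+ m n)) (sym (+-assoc _ _ _))

  *-fromℕ-∑ : ∀ {A : Set} a (xs : List A) (f : A → ℕ) →
              a * fromℕ K (ℕSum.∑ xs f) ≈ ∑ xs (λ x → a * fromℕ K (f x))
  *-fromℕ-∑ a []       f = zeroʳ a
  *-fromℕ-∑ a (x ∷ xs) f = begin
    a * fromℕ K (f x ℕ+ ℕSum.∑ xs f)                ≈⟨ *-cong ≈-refl (fromℕ-+ (f x) _) ⟩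
    a * (fromℕ K (f x) + fromℕ K (ℕSum.∑ xs f))     ≈⟨ distribˡ a _ _ ⟩
    a * fromℕ K (f x) + a * fromℕ K (ℕSum.∑ xs f)   ≈⟨ +-cong ≈-refl (*-fromℕ-∑ a xs f) ⟩
    a * fromℕ K (f x) + ∑ xs (λ x → a * fromℕ K (f x)) ∎

  ∑-if : ∀ {A : Set} (P : A → Bool) a xs →
         ∑ xs (λ x → if P x then a else 0#) ≈ a * fromℕ K (count P xs)
  ∑-if P a xs = sym (trans (*-fromℕ-∑ a xs _) (∑-cong xs indicator))
    where
    indicator : ∀ x → a * fromℕ K (if P x then 1 else 0) ≈ (if P x then a else 0#)
    indicator x with P x
    ... | true  = trans (*-cong ≈-refl (+-identityʳ 1#)) (*-identityʳ a)
    ... | false = zeroʳ a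

  coeff-bilin : ∀ {A B C : Set} (eq : C → C → Bool) s (op : A → B → List C) (x : LC A) (y : LC B) →
    coeff eq (bilin op x y) s ≈
    ∑ x (λ p → ∑ y (λ q →
      (proj₁ p * proj₁ q) * fromℕ K (count (λ t → eq t s) (op (proj₂ p) (proj₂ q)))))
  coeff-bilin eq s op x y = begin
    coeff eq (bilin op x y) s
      ≡⟨ coeff-∑ eq (bilin op x y) s ⟩
    ∑ (bilin op x y) (term eq s)
      ≈⟨ ∑-concatMap _ x (term eq s) ⟩
    ∑ x (λ p → ∑ (concatMap (λ q → map (λ t → proj₁ p * proj₁ q , t) (op (proj₂ p) (proj₂ q))) y)
               (term eq s))
      ≈⟨ ∑-cong x (λ p → trans (∑-concatMap _ y (term eq s)) (∑-cong y (λ q →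
           trans (∑-map _ (op (proj₂ p) (proj₂ q)) (term eq s))
                 (∑-if (λ t → eq t s) _ (op (proj₂ p) (proj₂ q)))))) ⟩
    ∑ x (λ p → ∑ y (λ q →
      (proj₁ p * proj₁ q) * fromℕ K (count (λ t → eq t s) (op (proj₂ p) (proj₂ q))))) ∎

  ∑-ψ : ∀ {n} (x : LC (Graph n)) (f : Carrier × (Graph n × Fin n) → Carrier) →
        ∑ (ψ x) f ≈ ∑ x (λ p → ∑ (allFin n) (λ r → f (proj₁ p , proj₂ p , r)))
  ∑-ψ {n} x f = trans (∑-concatMap _ x f) (∑-cong x (λ p → ∑-map _ (allFin n) f))

  ∑-root : ∀ {n} (π : Fin n → Fin n) {ρ ρ′} → π ρ′ ≡ ρ → (∀ {r} → π r ≡ ρ → r ≡ ρ′) →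
           ∀ b a → ∑ (allFin n) (λ r → if b ∧ (π r == ρ) then a else 0#) ≈ (if b then a else 0#)
  ∑-root {n} π πρ′≡ρ ≡ρ′ false a = ∑-ε (allFin n) (λ _ → ≈-refl)
  ∑-root {n} π {ρ} {ρ′} πρ′≡ρ ≡ρ′ true  a =
    trans (∑-allFin-single ρ′ _ (λ r r≢ρ′ → if-false a (==-≢ (r≢ρ′ ∘ ≡ρ′))))
          (if-true a (≡.subst (λ v → (π ρ′ == v) ≡ true) πρ′≡ρ (==-refl (π ρ′))))

  coeff-ψ : ∀ {n} (z : LC (Graph n)) G ρ → coeff eqRooted (ψ z) (G , ρ) ≈ coeff eqGraph z G
  coeff-ψ {n} z G ρ = begin
    coeff eqRooted (ψ z) (G , ρ)
      ≡⟨ coeff-∑ eqRooted (ψ z) (G , ρ) ⟩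
    ∑ (ψ z) (term eqRooted (G , ρ))
      ≈⟨ ∑-ψ z _ ⟩
    ∑ z (λ p → ∑ (allFin n) (λ r → if eqGraph (proj₂ p) G ∧ (r == ρ) then proj₁ p else 0#))
      ≈⟨ ∑-cong z (λ p → ∑-root id {ρ} ≡.refl id (eqGraph (proj₂ p) G) (proj₁ p)) ⟩
    ∑ z (term eqGraph G)
      ≡⟨ coeff-∑ eqGraph z G ⟨
    coeff eqGraph z G ∎

  ψ-resp : ∀ {n} (x y : LC (Graph n)) → x ≋T y → ψ x ≋PL ψ y
  ψ-resp x y x≋y (G , ρ) = trans (coeff-ψ x G ρ) (trans (x≋y G) (sym (coeff-ψ y G ρ)))

  ψ-injective : ∀ {n} (x y : LC (Graph (suc n))) → ψ x ≋PL ψ y → x ≋T y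
  ψ-injective x y ψx≋ψy G =
    trans (sym (coeff-ψ x G zero)) (trans (ψx≋ψy (G , zero)) (coeff-ψ y G zero))

  ψ-InPL : ∀ {n} {x : LC (Graph n)} → InKT x → InPL (ψ x)
  ψ-InPL = AllP.concat⁺ ∘ AllP.map⁺ ∘ All.map (λ tree → AllP.map⁺ (All.tabulate (λ _ → tree)))

  ψ-equivariant : ∀ {n} (σ : Permutation′ n) (x : LC (Graph n)) → ψ (actT σ x) ≋PL actPL σ (ψ x)
  ψ-equivariant {n} σ x (G , ρ) = begin
    coeff eqRooted (ψ (actT σ x)) (G , ρ)
      ≈⟨ coeff-ψ (actT σ x) G ρ ⟩
    coeff eqGraph (actT σ x) G
      ≡⟨ coeff-∑ eqGraph (actT σ x) G ⟩
    ∑ (actT σ x) (term eqGraph G)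
      ≈⟨ ∑-map _ x (term eqGraph G) ⟩
    ∑ x (λ p → if eqGraph (relabel σ (proj₂ p)) G then proj₁ p else 0#)
      ≈⟨ ∑-cong x (λ p →
           ∑-root (σ ⟨$⟩ʳ_) (inverseʳ σ) σr≡ρ (eqGraph (relabel σ (proj₂ p)) G) (proj₁ p)) ⟨
    ∑ x (λ p → ∑ (allFin n) (λ r → term eqRooted (G , ρ) (proj₁ p , relabelR σ (proj₂ p , r))))
      ≈⟨ ∑-ψ x _ ⟨
    ∑ (ψ x) (λ q → term eqRooted (G , ρ) (proj₁ q , relabelR σ (proj₂ q)))
      ≈⟨ ∑-map _ (ψ x) (term eqRooted (G , ρ)) ⟨
    ∑ (actPL σ (ψ x)) (term eqRooted (G , ρ))
      ≡⟨ coeff-∑ eqRooted (actPL σ (ψ x)) (G , ρ) ⟨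
    coeff eqRooted (actPL σ (ψ x)) (G , ρ) ∎
    where
    σr≡ρ : ∀ {r} → σ ⟨$⟩ʳ r ≡ ρ → r ≡ σ ⟨$⟩ˡ ρ
    σr≡ρ σr≡ρ = ≡.trans (≡.sym (inverseˡ σ)) (≡.cong (σ ⟨$⟩ˡ_) σr≡ρ)

  ψ-∘ : ∀ {m k} i (x : LC (Graph (suc m))) (y : LC (Graph k)) → InKT x →
        ψ (x ∘T[ i ] y) ≋PL (ψ x ∘PL[ i ] ψ y)
  ψ-∘ {m} {k} i x y trees (G , ρ) = trans lhs (sym rhs)
    where
    mult : Carrier × Graph (suc m) → Carrier × Graph k → Fin (suc m) → Fin k → ℕ
    mult p q r₁ r₂ = CompositionCount.multPL i (proj₂ p) (proj₂ q) G r₁ r₂ ρ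

    summand : Carrier × Graph (suc m) → Carrier × Graph k → Fin (suc m) → Fin k → Carrier
    summand p q r₁ r₂ = (proj₁ p * proj₁ q) * fromℕ K (mult p q r₁ r₂)

    total : Carrier
    total = ∑ x (λ p → ∑ y (λ q → ∑ (allFin (suc m)) (λ r₁ → ∑ (allFin k) (summand p q r₁))))

    lhs : coeff eqRooted (ψ (x ∘T[ i ] y)) (G , ρ) ≈ total
    lhs = begin
      coeff eqRooted (ψ (x ∘T[ i ] y)) (G , ρ)
        ≈⟨ coeff-ψ (x ∘T[ i ] y) G ρ ⟩
      coeff eqGraph (x ∘T[ i ] y) G
        ≈⟨ coeff-bilin eqGraph G (λ t₁ t₂ → compT t₁ i t₂) x y ⟩
      ∑ x (λ p → ∑ y (λ q →
        (proj₁ p * proj₁ q) * fromℕ K (CompositionCount.multT i (proj₂ p) (proj₂ q) G)))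
        ≈⟨ ∑-cong-All trees (λ tree → ∑-cong y (λ q → pairwise tree q)) ⟩
      total ∎
      where
      pairwise : ∀ {p} → IsTree (proj₂ p) → ∀ q →
                 (proj₁ p * proj₁ q) * fromℕ K (CompositionCount.multT i (proj₂ p) (proj₂ q) G) ≈
                 ∑ (allFin (suc m)) (λ r₁ → ∑ (allFin k) (summand p q r₁))
      pairwise {p} tree q = begin
        (proj₁ p * proj₁ q) * fromℕ K (CompositionCount.multT i (proj₂ p) (proj₂ q) G)
          ≡⟨ ≡.cong (λ n → (proj₁ p * proj₁ q) * fromℕ K n)
               (CompositionCount.multT≡multψ i (proj₂ p) (proj₂ q) G tree ρ) ⟩
        (proj₁ p * proj₁ q) * fromℕ K (CompositionCount.multψ i (proj₂ p) (proj₂ q) G ρ)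
          ≈⟨ *-fromℕ-∑ _ (allFin (suc m)) (λ r₁ → ℕSum.∑ (allFin k) (mult p q r₁)) ⟩
        ∑ (allFin (suc m)) (λ r₁ → (proj₁ p * proj₁ q) * fromℕ K (ℕSum.∑ (allFin k) (mult p q r₁)))
          ≈⟨ ∑-cong (allFin (suc m)) (λ r₁ → *-fromℕ-∑ _ (allFin k) (mult p q r₁)) ⟩
        ∑ (allFin (suc m)) (λ r₁ → ∑ (allFin k) (summand p q r₁)) ∎

    rhs : coeff eqRooted (ψ x ∘PL[ i ] ψ y) (G , ρ) ≈ total
    rhs = begin
      coeff eqRooted (ψ x ∘PL[ i ] ψ y) (G , ρ)
        ≈⟨ coeff-bilin eqRooted (G , ρ) (λ t₁ t₂ → compPL t₁ i t₂) (ψ x) (ψ y) ⟩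
      ∑ (ψ x) (λ p′ → ∑ (ψ y) (rootedSummand p′))
        ≈⟨ ∑-ψ x _ ⟩
      ∑ x (λ p → ∑ (allFin (suc m)) (λ r₁ → ∑ (ψ y) (rootedSummand (proj₁ p , proj₂ p , r₁))))
        ≈⟨ ∑-cong x (λ p → ∑-cong (allFin (suc m)) (λ r₁ → ∑-ψ y _)) ⟩
      ∑ x (λ p → ∑ (allFin (suc m)) (λ r₁ → ∑ y (λ q → ∑ (allFin k) (summand p q r₁))))
        ≈⟨ ∑-cong x (λ p → ∑-comm (allFin (suc m)) y _) ⟩
      total ∎
      where
      rootedSummand : Carrier × (Graph (suc m) × Fin (suc m)) → Carrier × (Graph k × Fin k) → Carrier
      rootedSummand p′ q′ = (proj₁ p′ * proj₁ q′) *
        fromℕ K (count (λ t → eqRooted t (G , ρ)) (compPL (proj₂ p′) i (proj₂ q′)))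

mainTheorem5 : ∀ {c ℓ} (K : Field c ℓ) → CharacteristicZero K →
  let open Field K
      open Linear K
  in
  -- ψ is well defined on K T[V] (respects equality of vectors) and lands in PLie[V]
  (∀ n (x y : LC (Graph (suc n))) → InKT x → InKT y → x ≋T y → ψ x ≋PL ψ y)
  × (∀ n (x : LC (Graph (suc n))) → InKT x → InPL (ψ x))
  -- ψ is injective
  × (∀ n (x y : LC (Graph (suc n))) → InKT x → InKT y → ψ x ≋PL ψ y → x ≋T y)
  -- ψ commutes with the partial compositions
  × (∀ m k (i : Fin (suc m)) (x : LC (Graph (suc m))) (y : LC (Graph (suc k))) →
       InKT x → InKT y → ψ (x ∘T[ i ] y) ≋PL (ψ x ∘PL[ i ] ψ y))
  -- ψ commutes with the action of bijections (equivariance)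
  × (∀ n (σ : Permutation′ (suc n)) (x : LC (Graph (suc n))) →
       InKT x → ψ (actT σ x) ≋PL actPL σ (ψ x))
  -- ψ preserves the unit
  × (ψ ((1# , unitT) ∷ []) ≋PL ((1# , unitPL) ∷ []))
mainTheorem5 K _ =
  (λ _ x y _ _ → ψ-resp K x y) ,
  (λ _ _ → ψ-InPL K) ,
  (λ _ x y _ _ → ψ-injective K x y) ,
  (λ _ _ i x y trees _ → ψ-∘ K i x y trees) ,
  (λ _ σ x _ → ψ-equivariant K σ x) ,
  λ _ → Field.refl K
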